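{- Let $G$ be a connected $k$-regular undirected graph with $k\ge3$ and let $U$ be its Grover transfer matrix. Then \[(U^2)^-=SU^++U^+S.\]
   Context: For a finite simple connected undirected graph $G$, $A(G)=\{(u,v),(v,u)\mid uv\in E(G)\}$; for $a=(u,v)$, $o(a)=u$, $t(a)=v$, $a^{ -1}=(v,u)$. $S$ is indexed by $A(G)$ with $S_{ab}=\delta_{a,b^{ -1}}$; the Grover transfer matrix $U$ is indexed by $A(G)$ with $U_{ab}=\frac{2}{\deg t(b)}\delta_{t(b),o(a)}-\delta_{a^{ -1},b}$. For a real matrix $M$, the positive support $M^+$ (resp. negative support $M^-$) is the $\{0,1\}$-matrix with entry $1$ exactly where $M_{xy}>0$ (resp. $M_{xy}<0$). -}

module Defs where

open import Data.Bool using (Bool; true; false; T)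
open import Data.Unit using (tt)
open import Data.Nat as ℕ using (ℕ; zero; suc)
open import Data.Fin using (Fin; zero; suc; _≟_)
open import Data.Product using (Σ; _×_; _,_; proj₁; proj₂)
open import Data.Integer using (+_)
open import Data.Rational as ℚ using (ℚ; 0ℚ; 1ℚ)
import Data.Rational.Properties as ℚP
open import Relation.Nullary using (¬_; Dec; yes; no; does)
open import Relation.Binary.PropositionalEquality using (_≡_; subst)
open import Data.Bool using (_∧_)

record Graph (n : ℕ) : Set where
  field
    adj     : Fin n → Fin n → Bool
    adj-sym : ∀ u v → adj u v ≡ adj v u
    irrefl  : ∀ u → adj u u ≡ false
open Graph public

module _ {n : ℕ} (G : Graph n) where

  data Reach : Fin n → Fin n → Set where
    here : ∀ {u} → Reach u u
    step : ∀ {u v w} → T (adj G u v) → Reach v w → Reach u w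

  Connected : Set
  Connected = ∀ u v → Reach u v

  b2n : Bool → ℕ
  b2n true = 1
  b2n false = 0

  countFin : ∀ {m} → (Fin m → Bool) → ℕ
  countFin {zero}  f = 0
  countFin {suc m} f = b2n (f zero) ℕ.+ countFin (λ i → f (suc i))

  deg : Fin n → ℕ
  deg u = countFin (λ v → adj G u v)

  Regular : ℕ → Set
  Regular k = ∀ u → deg u ≡ k

  Arc : Set
  Arc = Σ (Fin n × Fin n) (λ p → T (adj G (proj₁ p) (proj₂ p)))

  o t : Arc → Fin n
  o a = proj₁ (proj₁ a)
  t a = proj₂ (proj₁ a)

  inv : Arc → Arc
  inv ((u , v) , e) = (v , u) , subst T (adj-sym G u v) e

  -- Kronecker deltas (as rationals); arcs are equal iff their endpoints are
  δV : Fin n → Fin n → ℚ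
  δV u v with u ≟ v
  ... | yes _ = 1ℚ
  ... | no  _ = 0ℚ

  δA : Arc → Arc → ℚ
  δA a b with does (o a ≟ o b) ∧ does (t a ≟ t b)
  ... | true  = 1ℚ
  ... | false = 0ℚ

  δAℕ : Arc → Arc → ℕ
  δAℕ a b with does (o a ≟ o b) ∧ does (t a ≟ t b)
  ... | true  = 1
  ... | false = 0

  -- 2 / d as a rational (d = 0 never occurs for d = deg t(b); it is set to 0 then)
  twoOver : ℕ → ℚ
  twoOver zero    = 0ℚ
  twoOver (suc m) = (+ 2) ℚ./ suc m

  Grover : Arc → Arc → ℚ
  Grover a b = (twoOver (deg (t b)) ℚ.* δV (t b) (o a)) ℚ.- δA (inv a) b

  Smat : Arc → Arc → ℕ
  Smat a b = δAℕ a (inv b)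

  sumFinℚ : ∀ {m} → (Fin m → ℚ) → ℚ
  sumFinℚ {zero}  f = 0ℚ
  sumFinℚ {suc m} f = f zero ℚ.+ sumFinℚ (λ i → f (suc i))

  sumFinℕ : ∀ {m} → (Fin m → ℕ) → ℕ
  sumFinℕ {zero}  f = 0
  sumFinℕ {suc m} f = f zero ℕ.+ sumFinℕ (λ i → f (suc i))

  guardℚ : (b : Bool) → (T b → ℚ) → ℚ
  guardℚ true  f = f tt
  guardℚ false f = 0ℚ

  guardℕ : (b : Bool) → (T b → ℕ) → ℕ
  guardℕ true  f = f tt
  guardℕ false f = 0

  sumArcℚ : (Arc → ℚ) → ℚ
  sumArcℚ f = sumFinℚ (λ u → sumFinℚ (λ v → guardℚ (adj G u v) (λ e → f ((u , v) , e))))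

  sumArcℕ : (Arc → ℕ) → ℕ
  sumArcℕ f = sumFinℕ (λ u → sumFinℕ (λ v → guardℕ (adj G u v) (λ e → f ((u , v) , e))))

  _⊛ℚ_ : (Arc → Arc → ℚ) → (Arc → Arc → ℚ) → Arc → Arc → ℚ
  (M ⊛ℚ N) a b = sumArcℚ (λ c → M a c ℚ.* N c b)

  _⊛ℕ_ : (Arc → Arc → ℕ) → (Arc → Arc → ℕ) → Arc → Arc → ℕ
  (M ⊛ℕ N) a b = sumArcℕ (λ c → M a c ℕ.* N c b)

  _⊕ℕ_ : (Arc → Arc → ℕ) → (Arc → Arc → ℕ) → Arc → Arc → ℕ
  (M ⊕ℕ N) a b = M a b ℕ.+ N a b

posSupp : {X : Set} → (X → X → ℚ) → X → X → ℕ
posSupp M x y with does (0ℚ ℚP.<? M x y)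
... | true  = 1
... | false = 0

negSupp : {X : Set} → (X → X → ℚ) → X → X → ℕ
negSupp M x y with does (M x y ℚP.<? 0ℚ)
... | true  = 1
... | false = 0

module Submission where

-- Put q = 2/k, so 0 < q < 1.  In a k-regular graph the Grover entry U_xy vanishes
-- unless x can follow y (o x = t y); on such a composable pair it equals q, or
-- q - 1 < 0 when x reverses y.  Consequently
--   * U⁺_xy is the indicator of "composable and not reversing" (posSupp-grover);
--   * (U²)_ab has the single summand c = (t b, o a), equal to
--     turn(t a = t b) · turn(o a = o b), which is negative exactly when exactly one
--     of the two equalities holds (negSupp-square);
--   * S is the arc-reversal permutation: (S M)_ab = M_{a⁻¹ b}, (M S)_ab = M_{a b⁻¹}.
-- Both sides of the proposition are therefore the indicator of
-- [t a = t b] xor [o a = o b].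

open import Defs
open import Data.Nat using (ℕ; _≤_)
open import Relation.Binary.PropositionalEquality using (_≡_)

open import Data.Nat as ℕ using (zero; suc; s≤s; z≤n)
import Data.Nat.Properties as ℕP
open import Data.Bool using (Bool; true; false; T; not; _∧_; _xor_)
open import Data.Unit using (tt)
open import Data.Empty using (⊥-elim)
open import Data.Fin using (Fin; zero; suc; _≟_)
import Data.Fin.Properties as FinP
open import Data.Product using (_×_; _,_; proj₁; proj₂)
open import Data.Integer as ℤ using (+_)
open import Data.Rational as ℚ using (ℚ; 0ℚ; 1ℚ; _<_)
import Data.Rational.Properties as ℚP
import Data.Rational.Unnormalised as ℚᵘ
import Data.Rational.Unnormalised.Properties as ℚᵘP
open import Function using (_∘_)
open import Relation.Nullary using (¬_; Dec; yes; no; does; contradiction)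
open import Relation.Nullary.Decidable using (dec-true; dec-false)
open import Relation.Binary.PropositionalEquality using (refl; sym; trans; cong; cong₂; subst; module ≡-Reasoning)

𝟙 : Bool → ℕ
𝟙 true  = 1
𝟙 false = 0

xor-as-sum : ∀ β γ → 𝟙 (β xor γ) ≡ 𝟙 (β ∧ not γ) ℕ.+ 𝟙 (γ ∧ not β)
xor-as-sum true  true  = refl
xor-as-sum true  false = refl
xor-as-sum false true  = refl
xor-as-sum false false = refl

witness : ∀ {A : Set} (d : Dec A) → T (does d) → A
witness (yes a) _ = a

≤⇒≯ : ∀ {p r} → p ℚ.≤ r → ¬ r < p
≤⇒≯ p≤r r<p = ℚP.<-irrefl refl (ℚP.<-≤-trans r<p p≤r)

posSupp-pos : ∀ {X : Set} (M : X → X → ℚ) {x y v} → M x y ≡ v → 0ℚ < v → posSupp M x y ≡ 1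
posSupp-pos M {x} {y} refl 0<v rewrite dec-true (0ℚ ℚP.<? M x y) 0<v = refl

posSupp-nonpos : ∀ {X : Set} (M : X → X → ℚ) {x y v} → M x y ≡ v → v ℚ.≤ 0ℚ → posSupp M x y ≡ 0
posSupp-nonpos M {x} {y} refl v≤0 rewrite dec-false (0ℚ ℚP.<? M x y) (≤⇒≯ v≤0) = refl

negSupp-neg : ∀ {X : Set} (M : X → X → ℚ) {x y v} → M x y ≡ v → v < 0ℚ → negSupp M x y ≡ 1
negSupp-neg M {x} {y} refl v<0 rewrite dec-true (M x y ℚP.<? 0ℚ) v<0 = refl

negSupp-nonneg : ∀ {X : Set} (M : X → X → ℚ) {x y v} → M x y ≡ v → 0ℚ ℚ.≤ v → negSupp M x y ≡ 0
negSupp-nonneg M {x} {y} refl 0≤v rewrite dec-false (M x y ℚP.<? 0ℚ) (≤⇒≯ 0≤v) = refl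

-- The two values a Grover entry takes on a composable pair of arcs: q for a
-- non-reversing step, q - 1 for a reversal.
turn : ℚ → Bool → ℚ
turn q false = q
turn q true  = q ℚ.- 1ℚ

module TurnSigns {q : ℚ} (0<q : 0ℚ < q) (q<1 : q < 1ℚ) where

  instance
    forward-pos : ℚ.Positive (turn q false)
    forward-pos = ℚ.positive 0<q

    reversal-neg : ℚ.Negative (turn q true)
    reversal-neg = ℚ.negative (subst (q ℚ.- 1ℚ <_) (ℚP.+-inverseʳ 1ℚ) (ℚP.+-monoˡ-< (ℚ.- 1ℚ) q<1))

  posSupp-turn : ∀ {X : Set} (M : X → X → ℚ) {x y} β → M x y ≡ turn q β → posSupp M x y ≡ 𝟙 (not β)
  posSupp-turn M false eq = posSupp-pos M eq (ℚP.positive⁻¹ (turn q false))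
  posSupp-turn M true  eq = posSupp-nonpos M eq (ℚP.<⇒≤ (ℚP.negative⁻¹ (turn q true)))

  negSupp-turns : ∀ {X : Set} (M : X → X → ℚ) {x y} β γ →
    M x y ≡ turn q β ℚ.* turn q γ → negSupp M x y ≡ 𝟙 (β xor γ)
  negSupp-turns M false false eq =
    negSupp-nonneg M eq (ℚP.<⇒≤ (ℚP.positive⁻¹ _ {{ℚP.pos*pos⇒pos (turn q false) (turn q false)}}))
  negSupp-turns M false true eq =
    negSupp-neg M eq (ℚP.negative⁻¹ _ {{ℚP.pos*neg⇒neg (turn q false) (turn q true)}})
  negSupp-turns M true false eq =
    negSupp-neg M eq (ℚP.negative⁻¹ _ {{ℚP.neg*pos⇒neg (turn q true) (turn q false)}})
  negSupp-turns M true true eq =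
    negSupp-nonneg M eq (ℚP.<⇒≤ (ℚP.positive⁻¹ _ {{ℚP.neg*neg⇒pos (turn q true) (turn q true)}}))

twoOver-bounds : ∀ {n} (G : Graph n) {k} → 3 ≤ k → 0ℚ < twoOver G k × twoOver G k < 1ℚ
twoOver-bounds G {suc (suc (suc m))} (s≤s (s≤s (s≤s z≤n))) = 0<q , q<1
  where
  0<q : 0ℚ < (+ 2) ℚ./ suc (suc (suc m))
  0<q = ℚP.positive⁻¹ _ {{ℚP.normalize-pos 2 (suc (suc (suc m)))}}
  -- 2/(m+3) = fromℚᵘ (2/(m+3)), and 2·1 < 1·(m+3) in ℚᵘ
  q<1 : (+ 2) ℚ./ suc (suc (suc m)) < 1ℚ
  q<1 = ℚP.toℚᵘ-cancel-< (ℚᵘP.<-respˡ-≃ (ℚᵘP.≃-sym (ℚP.toℚᵘ-fromℚᵘ (ℚᵘ.mkℚᵘ (+ 2) (suc (suc m)))))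
          (ℚᵘ.*<* (ℤ.+<+ (s≤s (s≤s (s≤s z≤n))))))

-- Finite sums (over Fin m and over the arcs of G) whose summand vanishes off a
-- single index; every matrix product below has at most one non-zero term.
module SingleTermSums {n : ℕ} (G : Graph n) where

  sumFinℚ-vanish : ∀ {m} (f : Fin m → ℚ) → (∀ i → f i ≡ 0ℚ) → sumFinℚ G f ≡ 0ℚ
  sumFinℚ-vanish {zero}  f f≡0 = refl
  sumFinℚ-vanish {suc m} f f≡0 = cong₂ ℚ._+_ (f≡0 zero) (sumFinℚ-vanish (f ∘ suc) (f≡0 ∘ suc))

  sumFinℚ-single : ∀ {m} (f : Fin m → ℚ) j → (∀ i → ¬ i ≡ j → f i ≡ 0ℚ) → sumFinℚ G f ≡ f j
  sumFinℚ-single f zero f≡0 =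
    trans (cong (f zero ℚ.+_) (sumFinℚ-vanish (f ∘ suc) (λ i → f≡0 (suc i) λ ()))) (ℚP.+-identityʳ (f zero))
  sumFinℚ-single f (suc j) f≡0 =
    trans (cong₂ ℚ._+_ (f≡0 zero λ ()) (sumFinℚ-single (f ∘ suc) j (λ i i≢j → f≡0 (suc i) (i≢j ∘ FinP.suc-injective))))
          (ℚP.+-identityˡ (f (suc j)))

  sumFinℕ-vanish : ∀ {m} (f : Fin m → ℕ) → (∀ i → f i ≡ 0) → sumFinℕ G f ≡ 0
  sumFinℕ-vanish {zero}  f f≡0 = refl
  sumFinℕ-vanish {suc m} f f≡0 = cong₂ ℕ._+_ (f≡0 zero) (sumFinℕ-vanish (f ∘ suc) (f≡0 ∘ suc))

  sumFinℕ-single : ∀ {m} (f : Fin m → ℕ) j → (∀ i → ¬ i ≡ j → f i ≡ 0) → sumFinℕ G f ≡ f j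
  sumFinℕ-single f zero f≡0 =
    trans (cong (f zero ℕ.+_) (sumFinℕ-vanish (f ∘ suc) (λ i → f≡0 (suc i) λ ()))) (ℕP.+-identityʳ (f zero))
  sumFinℕ-single f (suc j) f≡0 =
    cong₂ ℕ._+_ (f≡0 zero λ ()) (sumFinℕ-single (f ∘ suc) j (λ i i≢j → f≡0 (suc i) (i≢j ∘ FinP.suc-injective)))

  guardℚ-vanish : ∀ s (g : T s → ℚ) → (∀ e → g e ≡ 0ℚ) → guardℚ G s g ≡ 0ℚ
  guardℚ-vanish true  g g≡0 = g≡0 tt
  guardℚ-vanish false g g≡0 = refl

  guardℚ-cong : ∀ s {g h : T s → ℚ} → (∀ e → g e ≡ h e) → guardℚ G s g ≡ guardℚ G s h
  guardℚ-cong true  g≡h = g≡h tt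
  guardℚ-cong false g≡h = refl

  guardℕ-vanish : ∀ s (g : T s → ℕ) → (∀ e → g e ≡ 0) → guardℕ G s g ≡ 0
  guardℕ-vanish true  g g≡0 = g≡0 tt
  guardℕ-vanish false g g≡0 = refl

  guardℕ-true : ∀ s (e : T s) (g : T s → ℕ) → guardℕ G s g ≡ g e
  guardℕ-true true tt g = refl

  sumArcℚ-single : (F : Arc G → ℚ) (u v : Fin n) → (∀ c → ¬ (o G c ≡ u × t G c ≡ v) → F c ≡ 0ℚ) →
    sumArcℚ G F ≡ guardℚ G (adj G u v) (λ e → F ((u , v) , e))
  sumArcℚ-single F u v F≡0 =
    trans (sumFinℚ-single _ u λ u′ u′≢u → sumFinℚ-vanish _ λ v′ → guardℚ-vanish (adj G u′ v′) _ λ _ → F≡0 _ (u′≢u ∘ proj₁))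
          (sumFinℚ-single _ v λ v′ v′≢v → guardℚ-vanish (adj G u v′) _ λ _ → F≡0 _ (v′≢v ∘ proj₂))

  sumArcℕ-at : (F : Arc G → ℕ) (c : Arc G) → (∀ d → ¬ (o G d ≡ o G c × t G d ≡ t G c) → F d ≡ 0) →
    sumArcℕ G F ≡ F c
  sumArcℕ-at F c F≡0 =
    trans (sumFinℕ-single _ (o G c) λ u′ u′≢u → sumFinℕ-vanish _ λ v′ → guardℕ-vanish (adj G u′ v′) _ λ _ → F≡0 _ (u′≢u ∘ proj₁))
    (trans (sumFinℕ-single _ (t G c) λ v′ v′≢v → guardℕ-vanish (adj G (o G c) v′) _ λ _ → F≡0 _ (v′≢v ∘ proj₂))
           (guardℕ-true (adj G (o G c) (t G c)) (proj₂ c) _))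

module Deltas {n : ℕ} (G : Graph n) where

  δV-same : ∀ {u v} → u ≡ v → δV G u v ≡ 1ℚ
  δV-same {u} {v} u≡v with u ≟ v
  ... | yes _   = refl
  ... | no  u≢v = contradiction u≡v u≢v

  δV-apart : ∀ {u v} → ¬ u ≡ v → δV G u v ≡ 0ℚ
  δV-apart {u} {v} u≢v with u ≟ v
  ... | yes u≡v = contradiction u≡v u≢v
  ... | no  _   = refl

  δA-same : ∀ x y → o G x ≡ o G y → t G x ≡ t G y → δA G x y ≡ 1ℚ
  δA-same x y ox≡oy tx≡ty rewrite dec-true (o G x ≟ o G y) ox≡oy | dec-true (t G x ≟ t G y) tx≡ty = refl

  δA-apart : ∀ x y → ¬ (o G x ≡ o G y × t G x ≡ t G y) → δA G x y ≡ 0ℚ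
  δA-apart x y x≢y with o G x ≟ o G y | t G x ≟ t G y
  ... | yes ox≡oy | yes tx≡ty = contradiction (ox≡oy , tx≡ty) x≢y
  ... | yes _     | no  _     = refl
  ... | no  _     | _         = refl

  δAℕ-same : ∀ x y → o G x ≡ o G y → t G x ≡ t G y → δAℕ G x y ≡ 1
  δAℕ-same x y ox≡oy tx≡ty rewrite dec-true (o G x ≟ o G y) ox≡oy | dec-true (t G x ≟ t G y) tx≡ty = refl

  δAℕ-apart : ∀ x y → ¬ (o G x ≡ o G y × t G x ≡ t G y) → δAℕ G x y ≡ 0
  δAℕ-apart x y x≢y with o G x ≟ o G y | t G x ≟ t G y
  ... | yes ox≡oy | yes tx≡ty = contradiction (ox≡oy , tx≡ty) x≢y
  ... | yes _     | no  _     = refl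
  ... | no  _     | _         = refl

module Reversal {n : ℕ} (G : Graph n) where
  open Deltas G
  open SingleTermSums G

  S-left : (M : Arc G → Arc G → ℕ) (a b : Arc G) → _⊛ℕ_ G (Smat G) M a b ≡ M (inv G a) b
  S-left M a b =
    trans (sumArcℕ-at (λ c → Smat G a c ℕ.* M c b) (inv G a) off-reverse)
          (trans (cong (ℕ._* M (inv G a) b) (δAℕ-same a (inv G (inv G a)) refl refl)) (ℕP.*-identityˡ _))
    where
    off-reverse : ∀ c → ¬ (o G c ≡ t G a × t G c ≡ o G a) → Smat G a c ℕ.* M c b ≡ 0
    off-reverse c c≢a⁻¹ = cong (ℕ._* M c b) (δAℕ-apart a (inv G c) λ (oa≡tc , ta≡oc) → c≢a⁻¹ (sym ta≡oc , sym oa≡tc))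

  S-right : (M : Arc G → Arc G → ℕ) (a b : Arc G) → _⊛ℕ_ G M (Smat G) a b ≡ M a (inv G b)
  S-right M a b =
    trans (sumArcℕ-at (λ c → M a c ℕ.* Smat G c b) (inv G b) off-reverse)
          (trans (cong (M a (inv G b) ℕ.*_) (δAℕ-same (inv G b) (inv G b) refl refl)) (ℕP.*-identityʳ _))
    where
    off-reverse : ∀ c → ¬ (o G c ≡ t G b × t G c ≡ o G b) → M a c ℕ.* Smat G c b ≡ 0
    off-reverse c c≢b⁻¹ = trans (cong (M a c ℕ.*_) (δAℕ-apart c (inv G b) c≢b⁻¹)) (ℕP.*-zeroʳ (M a c))

module RegularGrover {n : ℕ} (G : Graph n) {k : ℕ} (reg : Regular G k) where
  open Deltas G
  open SingleTermSums G

  U : Arc G → Arc G → ℚ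
  U = Grover G

  q : ℚ
  q = twoOver G k

  grover-value : ∀ x y {d d′} → δV G (t G y) (o G x) ≡ d → δA G (inv G x) y ≡ d′ → U x y ≡ q ℚ.* d ℚ.- d′
  grover-value x y δV≡d δA≡d′ =
    cong₂ ℚ._-_ (cong₂ (λ w d → twoOver G w ℚ.* d) (reg (t G y)) δV≡d) δA≡d′

  grover-composable : ∀ x y → o G x ≡ t G y → U x y ≡ turn q (does (t G x ≟ o G y))
  grover-composable x y ox≡ty = by-reversal (t G x ≟ o G y)
    where
    by-reversal : (reverses : Dec (t G x ≡ o G y)) → U x y ≡ turn q (does reverses)
    by-reversal (yes tx≡oy) =
      trans (grover-value x y (δV-same (sym ox≡ty)) (δA-same (inv G x) y tx≡oy ox≡ty))
            (cong (ℚ._- 1ℚ) (ℚP.*-identityʳ q))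
    by-reversal (no tx≢oy) =
      trans (grover-value x y (δV-same (sym ox≡ty)) (δA-apart (inv G x) y (tx≢oy ∘ proj₁)))
            (trans (ℚP.+-identityʳ _) (ℚP.*-identityʳ q))

  grover-apart : ∀ x y → ¬ o G x ≡ t G y → U x y ≡ 0ℚ
  grover-apart x y ox≢ty =
    trans (grover-value x y (δV-apart (ox≢ty ∘ sym)) (δA-apart (inv G x) y (ox≢ty ∘ proj₂)))
          (trans (ℚP.+-identityʳ _) (ℚP.*-zeroʳ q))

  square-entry : ∀ a b → _⊛ℚ_ G U U a b
    ≡ guardℚ G (adj G (t G b) (o G a)) (λ _ → turn q (does (t G a ≟ t G b)) ℚ.* turn q (does (o G a ≟ o G b)))
  square-entry a b =
    trans (sumArcℚ-single (λ c → U a c ℚ.* U c b) (t G b) (o G a) off-path)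
          (guardℚ-cong (adj G (t G b) (o G a)) λ e →
             cong₂ ℚ._*_ (grover-composable a ((t G b , o G a) , e) refl) (grover-composable ((t G b , o G a) , e) b refl))
    where
    off-path : ∀ c → ¬ (o G c ≡ t G b × t G c ≡ o G a) → U a c ℚ.* U c b ≡ 0ℚ
    off-path c c-off = by-first-step (o G a ≟ t G c)
      where
      by-first-step : Dec (o G a ≡ t G c) → U a c ℚ.* U c b ≡ 0ℚ
      by-first-step (no  oa≢tc) = trans (cong (ℚ._* U c b) (grover-apart a c oa≢tc)) (ℚP.*-zeroˡ (U c b))
      by-first-step (yes oa≡tc) =
        trans (cong (U a c ℚ.*_) (grover-apart c b λ oc≡tb → c-off (oc≡tb , sym oa≡tc))) (ℚP.*-zeroʳ (U a c))

  module Supports (0<q : 0ℚ < q) (q<1 : q < 1ℚ) where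
    open TurnSigns 0<q q<1

    posSupp-grover : ∀ x y → posSupp U x y ≡ 𝟙 (does (o G x ≟ t G y) ∧ not (does (t G x ≟ o G y)))
    posSupp-grover x y = by-composability (o G x ≟ t G y)
      where
      by-composability : (composable : Dec (o G x ≡ t G y)) →
        posSupp U x y ≡ 𝟙 (does composable ∧ not (does (t G x ≟ o G y)))
      by-composability (yes ox≡ty) = posSupp-turn U {x} {y} _ (grover-composable x y ox≡ty)
      by-composability (no  ox≢ty) = posSupp-nonpos U {x} {y} (grover-apart x y ox≢ty) ℚP.≤-refl

    negSupp-guarded-turns : ∀ {X : Set} (M : X → X → ℚ) {x y} s β γ →
      M x y ≡ guardℚ G s (λ _ → turn q β ℚ.* turn q γ) → (T β → T s) → (T γ → T s) →
      negSupp M x y ≡ 𝟙 (β xor γ)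
    negSupp-guarded-turns M true  β     γ     eq _    _    = negSupp-turns M β γ eq
    negSupp-guarded-turns M false false false eq _    _    = negSupp-nonneg M eq ℚP.≤-refl
    negSupp-guarded-turns M false true  γ     eq β⇒s _    = ⊥-elim (β⇒s tt)
    negSupp-guarded-turns M false false true  eq _    γ⇒s = ⊥-elim (γ⇒s tt)

    negSupp-square : ∀ a b → negSupp (_⊛ℚ_ G U U) a b ≡ 𝟙 (does (t G a ≟ t G b) xor does (o G a ≟ o G b))
    negSupp-square a b = negSupp-guarded-turns (_⊛ℚ_ G U U) {a} {b} _ _ _ (square-entry a b) via-a⁻¹ via-b⁻¹
      where
      via-a⁻¹ : T (does (t G a ≟ t G b)) → T (adj G (t G b) (o G a))
      via-a⁻¹ ta≡tb = subst (λ w → T (adj G w (o G a))) (witness (t G a ≟ t G b) ta≡tb) (proj₂ (inv G a))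
      via-b⁻¹ : T (does (o G a ≟ o G b)) → T (adj G (t G b) (o G a))
      via-b⁻¹ oa≡ob = subst (λ w → T (adj G (t G b) w)) (sym (witness (o G a ≟ o G b) oa≡ob)) (proj₂ (inv G b))

proposition6p10 : (n k : ℕ) (G : Graph n) → Connected G → Regular G k → 3 ≤ k →
    (a b : Arc G) →
    negSupp (_⊛ℚ_ G (Grover G) (Grover G)) a b
    ≡ _⊕ℕ_ G (_⊛ℕ_ G (Smat G) (posSupp (Grover G))) (_⊛ℕ_ G (posSupp (Grover G)) (Smat G)) a b
proposition6p10 _ _ G _ reg 3≤k a b =
  begin
    negSupp (_⊛ℚ_ G U U) a b                        ≡⟨ negSupp-square a b ⟩
    𝟙 (same-target xor same-origin)                  ≡⟨ xor-as-sum same-target same-origin ⟩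
    𝟙 (same-target ∧ not same-origin) ℕ.+ 𝟙 (same-origin ∧ not same-target)
      ≡⟨ cong₂ ℕ._+_ (posSupp-grover (inv G a) b) (posSupp-grover a (inv G b)) ⟨
    posSupp U (inv G a) b ℕ.+ posSupp U a (inv G b)
      ≡⟨ cong₂ ℕ._+_ (S-left (posSupp U) a b) (S-right (posSupp U) a b) ⟨
    _⊕ℕ_ G (_⊛ℕ_ G (Smat G) (posSupp U)) (_⊛ℕ_ G (posSupp U) (Smat G)) a b
  ∎
  where
  open ≡-Reasoning
  open Reversal G
  open RegularGrover G reg
  open Supports (proj₁ (twoOver-bounds G 3≤k)) (proj₂ (twoOver-bounds G 3≤k))
  same-target = does (t G a ≟ t G b)
  same-origin = does (o G a ≟ o G b)
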